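{- Let $A_1,\dots,A_k$ be independent events with probabilities $p_1,\dots,p_k$. Let $r_1,\dots,r_k$ be non-negative constants such that for every $S\subseteq\{1,\dots,k\}$, $$\sum_{i\in S} r_i \le 1-\prod_{i\in S}(1-p_i).$$ Then there is a probability distribution over permutations $\pi$ of $\{1,\dots,k\}$ (chosen independently of the events) such that for each $i$, $$\mathbf P\bigl(A_i \text{ is the earliest occurring event in the order } \pi\bigr)\ge r_i,$$ where "$A_i$ is the earliest occurring event in $\pi$" means that $A_i$ occurs and no $A_j$ with $j$ preceding $i$ in $\pi$ occurs.
   Formalization: The probabilities $p_1,\dots,p_k$ and the constants $r_1,\dots,r_k$ are rational, and the distribution over permutations is taken with rational weights. -}

module Defs where

open import Data.Bool using (Bool; true; false; if_then_else_; _∧_; _∨_; not)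
open import Data.Nat using (ℕ; zero; suc)
import Data.Nat as ℕ
open import Data.Fin using (Fin; toℕ)
open import Data.Fin.Permutation using (Permutation′; _⟨$⟩ʳ_)
open import Data.List using (List; []; _∷_)
open import Data.Product using (_×_; _,_)
open import Data.Rational using (ℚ; 0ℚ; 1ℚ; _+_; _*_; _-_)
open import Data.Vec.Functional using (Vector)
import Data.Vec.Functional as VF
open import Relation.Nullary.Decidable using (⌊_⌋)

Σᶠ : ∀ {k} → (Fin k → ℚ) → ℚ
Σᶠ f = VF.foldr _+_ 0ℚ f

Πᶠ : ∀ {k} → (Fin k → ℚ) → ℚ
Πᶠ f = VF.foldr _*_ 1ℚ f

allᶠ : ∀ {k} → (Fin k → Bool) → Bool
allᶠ f = VF.foldr _∧_ true f

-- Sum over all outcomes ω : Fin k → Bool (ω i = true  iff  event A_i occurs)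
ΣΩ : ∀ k → ((Fin k → Bool) → ℚ) → ℚ
ΣΩ zero    g = g (λ ())
ΣΩ (suc k) g = ΣΩ k (λ ω → g (true VF.∷ ω)) + ΣΩ k (λ ω → g (false VF.∷ ω))

weight : ∀ {k} → (Fin k → ℚ) → (Fin k → Bool) → ℚ
weight p ω = Πᶠ (λ i → if ω i then p i else (1ℚ - p i))

𝟙 : Bool → ℚ
𝟙 true  = 1ℚ
𝟙 false = 0ℚ

-- π sends an index to its position in the order; j precedes i iff pos j < pos i
precedes : ∀ {k} → Permutation′ k → Fin k → Fin k → Bool
precedes π j i = ⌊ toℕ (π ⟨$⟩ʳ j) ℕ.<? toℕ (π ⟨$⟩ʳ i) ⌋

earliest : ∀ {k} → Permutation′ k → (Fin k → Bool) → Fin k → Bool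
earliest π ω i = ω i ∧ allᶠ (λ j → not (precedes π j i) ∨ not (ω j))

Dist : ℕ → Set
Dist k = List (Permutation′ k × ℚ)

totalMass : ∀ {k} → Dist k → ℚ
totalMass [] = 0ℚ
totalMass ((_ , q) ∷ d) = q + totalMass d

probEarliest : ∀ {k} → (Fin k → ℚ) → Dist k → Fin k → ℚ
probEarliest {k} p [] i = 0ℚ
probEarliest {k} p ((π , q) ∷ d) i =
  q * ΣΩ k (λ ω → weight p ω * 𝟙 (earliest π ω i)) + probEarliest p d i

{-# OPTIONS --safe #-}
module Submission where

-- r lies in the polymatroid of the submodular function f(S) = 1 - ∏_{i∈S} (1 - p_i); the vertices of its base
-- are the vectors (P(A_i is earliest in π))_i, so r is dominated by a convex combination of them.
-- Constructively, by induction on |U|: if x(W) ≤ c·f(W) for all W ⊆ U, then x is dominated on U by c times a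
-- mixture of orders of U. If U has two elements a ≠ b, move mass from b to a until some W ∋ a with b ∉ W
-- becomes tight, and likewise from a to b; x is a convex combination of the two results. A tight set T splits
-- the problem: orders of T followed by orders of U ∖ T, since once all of T has been missed the remaining
-- events face the contracted bound x(W) ≤ c·∏_{i∈T}(1 - p_i)·f(W) on U ∖ T. Orders are lists, turned into
-- permutations that visit the listed elements first.

open import Defs
open import Data.Bool using (Bool; true; false; if_then_else_; _∧_; _∨_; not)
import Data.Bool as Bool
open import Data.Bool.Properties using (∧-identityʳ; ∧-zeroʳ; ∧-conicalˡ; ¬-not; if-eta)
open import Data.Fin using (Fin; zero; suc; toℕ; punchIn; punchOut; _≟_)
open import Data.Fin.Permutation using (Permutation′; _⟨$⟩ʳ_; id; insert; insert-punchIn)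
open import Data.Fin.Properties using (punchInᵢ≢i; punchIn-injective; punchIn-punchOut; any?)
open import Data.Nat using (ℕ; zero; suc)
import Data.Nat as ℕ
import Data.Nat.Properties as ℕP
open import Data.List using (List; []; _∷_; _++_; map; cartesianProductWith)
open import Data.List.Relation.Unary.All using (All; []; _∷_)
import Data.List.Relation.Unary.All as All
open import Data.List.Relation.Unary.All.Properties using (++⁺; map⁺)
open import Data.Product using (Σ; _×_; _,_; proj₁; proj₂)
open import Data.Sum using (_⊎_; inj₁; inj₂)
open import Data.Rational using (ℚ; 0ℚ; 1ℚ; _+_; _*_; _-_; -_; 1/_; _≤_; _<_; Positive; positive; nonNegative)
import Data.Rational.Properties as ℚP
open import Data.Rational.Solver using (module +-*-Solver)
open import Relation.Binary.PropositionalEquality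
open import Relation.Nullary using (Dec; yes; no; does; contradiction)
open import Relation.Nullary.Decidable using (⌊_⌋; dec-true; dec-false; _×-dec_; ¬?; decidable-stable)
open import Function using (_∘_; _on_)
open import Induction.WellFounded using (WfRec)
import Induction.WellFounded as WF
import Relation.Binary.Construct.On as On
import Data.Nat.Induction as ℕI
open import Relation.Binary.Definitions using (Tri; tri<; tri≈; tri>)
import Data.Vec.Functional as VF
import Algebra.Properties.CommutativeMonoid.Sum as MonoidSum
open +-*-Solver

module Sumᶠ = MonoidSum ℚP.+-0-commutativeMonoid
module Prodᶠ = MonoidSum ℚP.*-1-commutativeMonoid

0≤1 : 0ℚ ≤ 1ℚ
0≤1 = ℚP.nonNegative⁻¹ 1ℚ

0≤*0≤⇒0≤ : ∀ {a b} → 0ℚ ≤ a → 0ℚ ≤ b → 0ℚ ≤ a * b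
0≤*0≤⇒0≤ {a} {b} 0≤a 0≤b =
  ℚP.nonNegative⁻¹ (a * b) {{ℚP.nonNeg*nonNeg⇒nonNeg a {{nonNegative 0≤a}} b {{nonNegative 0≤b}}}}

*-monoʳ-≤-0≤ : ∀ {r a b} → 0ℚ ≤ r → a ≤ b → r * a ≤ r * b
*-monoʳ-≤-0≤ {r} 0≤r = ℚP.*-monoˡ-≤-nonNeg r {{nonNegative 0≤r}}

p≤q⇒0≤q-p : ∀ {p q} → p ≤ q → 0ℚ ≤ q - p
p≤q⇒0≤q-p {p} {q} p≤q = subst (_≤ q - p) (ℚP.+-inverseʳ p) (ℚP.+-monoˡ-≤ (- p) p≤q)

0≤q⇒p-q≤p : ∀ {p q} → 0ℚ ≤ q → p - q ≤ p
0≤q⇒p-q≤p {p} {q} 0≤q = subst (p - q ≤_) (ℚP.+-identityʳ p) (ℚP.+-monoʳ-≤ p (ℚP.neg-antimono-≤ 0≤q))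

q≤r-p⇒p+q≤r : ∀ {p q r} → q ≤ r - p → p + q ≤ r
q≤r-p⇒p+q≤r {p} {q} {r} q≤r-p =
  subst (p + q ≤_) (solve 2 (λ p r → p :+ (r :- p) := r) refl p r) (ℚP.+-monoʳ-≤ p q≤r-p)

p+q≤r⇒p≤r-q : ∀ {p q r} → p + q ≤ r → p ≤ r - q
p+q≤r⇒p≤r-q {p} {q} {r} p+q≤r =
  subst (_≤ r - q) (solve 2 (λ p q → (p :+ q) :- q := p) refl p q) (ℚP.+-monoˡ-≤ (- q) p+q≤r)

if-0≤ : ∀ b {x y} → 0ℚ ≤ x → 0ℚ ≤ y → 0ℚ ≤ (if b then x else y)
if-0≤ true  0≤x 0≤y = 0≤x
if-0≤ false 0≤x 0≤y = 0≤y

≤1⇒*≤ : ∀ {a v} → a ≤ 1ℚ → 0ℚ ≤ v → a * v ≤ v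
≤1⇒*≤ {a} {v} a≤1 0≤v = subst (a * v ≤_) (ℚP.*-identityˡ v) (ℚP.*-monoʳ-≤-nonNeg v {{nonNegative 0≤v}} a≤1)

Σᶠ-single : ∀ {n} (a : Fin (suc n)) (f : Fin (suc n) → ℚ) → (∀ y → f (punchIn a y) ≡ 0ℚ) → Σᶠ f ≡ f a
Σᶠ-single {n} a f off-a = begin
  Σᶠ f                        ≡⟨ Sumᶠ.sum-remove {i = a} f ⟩
  f a + Σᶠ (f ∘ punchIn a)    ≡⟨ cong (f a +_) (trans (Sumᶠ.sum-cong-≗ off-a) (Sumᶠ.sum-replicate-zero n)) ⟩
  f a + 0ℚ                    ≡⟨ ℚP.+-identityʳ (f a) ⟩
  f a                         ∎
  where open ≡-Reasoning

Πᶠ-single : ∀ {n} (a : Fin (suc n)) (f : Fin (suc n) → ℚ) → (∀ y → f (punchIn a y) ≡ 1ℚ) → Πᶠ f ≡ f a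
Πᶠ-single {n} a f off-a = begin
  Πᶠ f                        ≡⟨ Prodᶠ.sum-remove {i = a} f ⟩
  f a * Πᶠ (f ∘ punchIn a)    ≡⟨ cong (f a *_) (trans (Prodᶠ.sum-cong-≗ off-a) (Prodᶠ.sum-replicate-zero n)) ⟩
  f a * 1ℚ                    ≡⟨ ℚP.*-identityʳ (f a) ⟩
  f a                         ∎
  where open ≡-Reasoning

Πᶠ-0≤ : ∀ {k} (f : Fin k → ℚ) → (∀ i → 0ℚ ≤ f i) → 0ℚ ≤ Πᶠ f
Πᶠ-0≤ {zero}  f 0≤f = 0≤1
Πᶠ-0≤ {suc k} f 0≤f = 0≤*0≤⇒0≤ (0≤f zero) (Πᶠ-0≤ (f ∘ suc) (0≤f ∘ suc))

Subset : ℕ → Set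
Subset k = Fin k → Bool

infix  4 _∈_ _∉_ _⊆_
infixl 6 _∪_ _∖_

_∈_ : ∀ {k} → Fin k → Subset k → Set
i ∈ U = U i ≡ true

_∉_ : ∀ {k} → Fin k → Subset k → Set
i ∉ U = U i ≡ false

_⊆_ : ∀ {k} → Subset k → Subset k → Set
W ⊆ U = ∀ {i} → i ∈ W → i ∈ U

⁅_⁆ : ∀ {k} → Fin k → Subset k
⁅ a ⁆ i = does (i ≟ a)

_∪_ : ∀ {k} → Subset k → Subset k → Subset k
(W ∪ T) i = W i ∨ T i

_∖_ : ∀ {k} → Subset k → Subset k → Subset k
(U ∖ T) i = U i ∧ not (T i)

sumOn : ∀ {k} → Subset k → (Fin k → ℚ) → ℚ
sumOn W x = Σᶠ (λ i → if W i then x i else 0ℚ)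

prodOn : ∀ {k} → Subset k → (Fin k → ℚ) → ℚ
prodOn W y = Πᶠ (λ i → if W i then y i else 1ℚ)

∈∖⇒∈ : ∀ {k} {U T : Subset k} {i} → i ∈ U ∖ T → i ∈ U
∈∖⇒∈ {U = U} {i = i} i∈U∖T with U i
... | true = refl

∈∖⇒∉ : ∀ {k} {U T : Subset k} {i} → i ∈ U ∖ T → i ∉ T
∈∖⇒∉ {U = U} {T} {i} i∈U∖T with U i | T i
... | true | false = refl

∈∧∉⇒∈∖ : ∀ {k} {U T : Subset k} {i} → i ∈ U → i ∉ T → i ∈ U ∖ T
∈∧∉⇒∈∖ i∈U i∉T rewrite i∈U | i∉T = refl

∪-∖ : ∀ {k} {U T : Subset k} → T ⊆ U → (T ∪ (U ∖ T)) ≗ U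
∪-∖ {U = U} {T} T⊆U i with T i in Ti | U i in Ui
... | true  | true  = refl
... | true  | false = trans (sym (T⊆U Ti)) Ui
... | false | true  = refl
... | false | false = refl

sumOn-cong : ∀ {k} {W W′ : Subset k} (x : Fin k → ℚ) → W ≗ W′ → sumOn W x ≡ sumOn W′ x
sumOn-cong x W≗W′ = Sumᶠ.sum-cong-≗ (λ i → cong (if_then x i else 0ℚ) (W≗W′ i))

prodOn-cong : ∀ {k} {W W′ : Subset k} (y : Fin k → ℚ) → W ≗ W′ → prodOn W y ≡ prodOn W′ y
prodOn-cong y W≗W′ = Prodᶠ.sum-cong-≗ (λ i → cong (if_then y i else 1ℚ) (W≗W′ i))

sumOn-∪ : ∀ {k} {W T : Subset k} (x : Fin k → ℚ) → (∀ {i} → i ∈ W → i ∉ T) →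
          sumOn (W ∪ T) x ≡ sumOn W x + sumOn T x
sumOn-∪ {k} {W} {T} x disjoint = trans (Sumᶠ.sum-cong-≗ split) (Sumᶠ.∑-distrib-+ {k} _ _)
  where
  split : ∀ i → (if W i ∨ T i then x i else 0ℚ) ≡ (if W i then x i else 0ℚ) + (if T i then x i else 0ℚ)
  split i with W i in Wi | T i in Ti
  ... | true  | true  = contradiction (trans (sym Ti) (disjoint Wi)) λ ()
  ... | true  | false = sym (ℚP.+-identityʳ (x i))
  ... | false | true  = sym (ℚP.+-identityˡ (x i))
  ... | false | false = sym (ℚP.+-identityʳ 0ℚ)

prodOn-∪ : ∀ {k} {W T : Subset k} (y : Fin k → ℚ) → (∀ {i} → i ∈ W → i ∉ T) →
           prodOn (W ∪ T) y ≡ prodOn W y * prodOn T y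
prodOn-∪ {k} {W} {T} y disjoint = trans (Prodᶠ.sum-cong-≗ split) (Prodᶠ.∑-distrib-+ {k} _ _)
  where
  split : ∀ i → (if W i ∨ T i then y i else 1ℚ) ≡ (if W i then y i else 1ℚ) * (if T i then y i else 1ℚ)
  split i with W i in Wi | T i in Ti
  ... | true  | true  = contradiction (trans (sym Ti) (disjoint Wi)) λ ()
  ... | true  | false = sym (ℚP.*-identityʳ (y i))
  ... | false | true  = sym (ℚP.*-identityˡ (y i))
  ... | false | false = sym (ℚP.*-identityʳ 1ℚ)

prodOn-∖ : ∀ {k} {U T : Subset k} (y : Fin k → ℚ) → T ⊆ U → prodOn U y ≡ prodOn T y * prodOn (U ∖ T) y
prodOn-∖ {U = U} {T} y T⊆U = trans (sym (prodOn-cong y (∪-∖ T⊆U))) (prodOn-∪ y disjoint)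
  where
  disjoint : ∀ {i} → i ∈ T → i ∉ U ∖ T
  disjoint {i} i∈T rewrite i∈T = ∧-zeroʳ (U i)

a∈⁅a⁆ : ∀ {k} (a : Fin k) → a ∈ ⁅ a ⁆
a∈⁅a⁆ a = dec-true (a ≟ a) refl

punchIn∉⁅⁆ : ∀ {n} (a : Fin (suc n)) y → punchIn a y ∉ ⁅ a ⁆
punchIn∉⁅⁆ a y = dec-false (punchIn a y ≟ a) (punchInᵢ≢i a y)

sumOn-⁅⁆ : ∀ {k} (a : Fin k) (x : Fin k → ℚ) → sumOn ⁅ a ⁆ x ≡ x a
sumOn-⁅⁆ {suc n} a x =
  trans (Σᶠ-single a (λ i → if ⁅ a ⁆ i then x i else 0ℚ)
                     (λ y → cong (if_then x (punchIn a y) else 0ℚ) (punchIn∉⁅⁆ a y)))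
        (cong (if_then x a else 0ℚ) (a∈⁅a⁆ a))

prodOn-⁅⁆ : ∀ {k} (a : Fin k) (y : Fin k → ℚ) → prodOn ⁅ a ⁆ y ≡ y a
prodOn-⁅⁆ {suc n} a y =
  trans (Πᶠ-single a (λ i → if ⁅ a ⁆ i then y i else 1ℚ)
                     (λ z → cong (if_then y (punchIn a z) else 1ℚ) (punchIn∉⁅⁆ a z)))
        (cong (if_then y a else 1ℚ) (a∈⁅a⁆ a))

∣_∣ : ∀ {k} → Subset k → ℕ
∣_∣ {zero}  U = zero
∣_∣ {suc k} U = if U zero then suc ∣ U ∘ suc ∣ else ∣ U ∘ suc ∣

∣∣-mono-≤ : ∀ {k} {W U : Subset k} → W ⊆ U → ∣ W ∣ ℕ.≤ ∣ U ∣
∣∣-mono-≤ {zero}          W⊆U = ℕ.z≤n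
∣∣-mono-≤ {suc k} {W} {U} W⊆U with W zero in W₀ | U zero in U₀
... | true  | true  = ℕ.s≤s (∣∣-mono-≤ {W = W ∘ suc} {U ∘ suc} W⊆U)
... | false | true  = ℕP.m≤n⇒m≤1+n (∣∣-mono-≤ {W = W ∘ suc} {U ∘ suc} W⊆U)
... | false | false = ∣∣-mono-≤ {W = W ∘ suc} {U ∘ suc} W⊆U
... | true  | false = contradiction (trans (sym U₀) (W⊆U W₀)) λ ()

∣∣-mono-< : ∀ {k} {W U : Subset k} {e} → W ⊆ U → e ∈ U → e ∉ W → ∣ W ∣ ℕ.< ∣ U ∣
∣∣-mono-< {suc k} {W} {U} {zero} W⊆U e∈U e∉W rewrite e∈U | e∉W = ℕ.s≤s (∣∣-mono-≤ {W = W ∘ suc} {U ∘ suc} W⊆U)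
∣∣-mono-< {suc k} {W} {U} {suc e} W⊆U e∈U e∉W with W zero in W₀ | U zero in U₀
... | true  | true  = ℕ.s≤s (∣∣-mono-< {W = W ∘ suc} {U ∘ suc} W⊆U e∈U e∉W)
... | false | true  = ℕP.m≤n⇒m≤1+n (∣∣-mono-< {W = W ∘ suc} {U ∘ suc} W⊆U e∈U e∉W)
... | false | false = ∣∣-mono-< {W = W ∘ suc} {U ∘ suc} W⊆U e∈U e∉W
... | true  | false = contradiction (trans (sym U₀) (W⊆U W₀)) λ ()

minimiser : ∀ {n} (g : Subset n → ℚ) → (∀ {S S′} → S ≗ S′ → g S ≡ g S′) →
            Σ (Subset n) λ S → ∀ S′ → g S ≤ g S′
minimiser {zero}  g g-cong = (λ ()) , λ S′ → ℚP.≤-reflexive (g-cong λ ())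
minimiser {suc n} g g-cong = pick (ℚP.≤-total (g (true VF.∷ S₁)) (g (false VF.∷ S₀)))
  where
  minimiser-from : ∀ b → Σ (Subset n) λ S → ∀ S′ → g (b VF.∷ S) ≤ g (b VF.∷ S′)
  minimiser-from b = minimiser (λ S → g (b VF.∷ S)) (λ S≗S′ → g-cong λ { zero → refl ; (suc i) → S≗S′ i })
  S₁ = proj₁ (minimiser-from true)
  S₀ = proj₁ (minimiser-from false)
  below-all : ∀ S → (∀ b → g S ≤ g (b VF.∷ proj₁ (minimiser-from b))) → ∀ S′ → g S ≤ g S′
  below-all S ≤heads S′ =
    ℚP.≤-trans (≤heads (S′ zero)) (ℚP.≤-trans (proj₂ (minimiser-from (S′ zero)) (S′ ∘ suc))
                                              (ℚP.≤-reflexive (g-cong λ { zero → refl ; (suc i) → refl })))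
  pick : g (true VF.∷ S₁) ≤ g (false VF.∷ S₀) ⊎ g (false VF.∷ S₀) ≤ g (true VF.∷ S₁) →
         Σ (Subset (suc n)) λ S → ∀ S′ → g S ≤ g S′
  pick (inj₁ ≤₀) = (true VF.∷ S₁)  , below-all _ λ { true → ℚP.≤-refl ; false → ≤₀ }
  pick (inj₂ ≤₁) = (false VF.∷ S₀) , below-all _ λ { true → ≤₁ ; false → ℚP.≤-refl }

transfer : ∀ {k} → Fin k → Fin k → ℚ → (Fin k → ℚ) → Fin k → ℚ
transfer a b t x i = (x i + (if ⁅ a ⁆ i then t else 0ℚ)) + (if ⁅ b ⁆ i then - t else 0ℚ)

sumOn-bump : ∀ {k} (W : Subset k) a t (x : Fin k → ℚ) →
             sumOn W (λ i → x i + (if ⁅ a ⁆ i then t else 0ℚ)) ≡ sumOn W x + (if W a then t else 0ℚ)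
sumOn-bump {k} W a t x = begin
  sumOn W (λ i → x i + (if ⁅ a ⁆ i then t else 0ℚ))
    ≡⟨ Sumᶠ.sum-cong-≗ split ⟩
  Σᶠ (λ i → (if W i then x i else 0ℚ) + (if ⁅ a ⁆ i then (if W i then t else 0ℚ) else 0ℚ))
    ≡⟨ Sumᶠ.∑-distrib-+ {k} _ _ ⟩
  sumOn W x + sumOn ⁅ a ⁆ (λ i → if W i then t else 0ℚ)
    ≡⟨ cong (sumOn W x +_) (sumOn-⁅⁆ a (λ i → if W i then t else 0ℚ)) ⟩
  sumOn W x + (if W a then t else 0ℚ) ∎
  where
  open ≡-Reasoning
  split : ∀ i → (if W i then x i + (if ⁅ a ⁆ i then t else 0ℚ) else 0ℚ)
              ≡ (if W i then x i else 0ℚ) + (if ⁅ a ⁆ i then (if W i then t else 0ℚ) else 0ℚ)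
  split i with W i | ⁅ a ⁆ i
  ... | true  | _     = refl
  ... | false | true  = sym (ℚP.+-identityʳ 0ℚ)
  ... | false | false = sym (ℚP.+-identityʳ 0ℚ)

sumOn-transfer : ∀ {k} (W : Subset k) a b t (x : Fin k → ℚ) →
  sumOn W (transfer a b t x) ≡ (sumOn W x + (if W a then t else 0ℚ)) + (if W b then - t else 0ℚ)
sumOn-transfer W a b t x =
  trans (sumOn-bump W b (- t) (λ i → x i + (if ⁅ a ⁆ i then t else 0ℚ))) (cong (_+ _) (sumOn-bump W a t x))

transfer-zero : ∀ {k} a b (x : Fin k → ℚ) → transfer a b 0ℚ x ≗ x
transfer-zero a b x i =
  trans (cong₂ (λ u v → (x i + u) + v) (if-eta (⁅ a ⁆ i)) (if-eta (⁅ b ⁆ i)))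
        (trans (ℚP.+-identityʳ _) (ℚP.+-identityʳ (x i)))

if-then-0≡*𝟙 : ∀ α (v : ℚ) → (if α then v else 0ℚ) ≡ v * 𝟙 α
if-then-0≡*𝟙 true  v = sym (ℚP.*-identityʳ v)
if-then-0≡*𝟙 false v = sym (ℚP.*-zeroʳ v)

transfer-convex : ∀ {k} a b t s inv (x : Fin k → ℚ) → (t + s) * inv ≡ 1ℚ →
                  ∀ i → x i ≡ (s * inv) * transfer a b t x i + (t * inv) * transfer b a s x i
transfer-convex a b t s inv x [t+s]inv≡1 i = begin
  x i
    ≡⟨ sym (trans (cong (x i *_) [t+s]inv≡1) (ℚP.*-identityʳ (x i))) ⟩
  x i * ((t + s) * inv)
    ≡⟨ solve 6 (λ x t s inv A B → x :* ((t :+ s) :* inv)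
                  := (s :* inv) :* ((x :+ t :* A) :+ (:- t) :* B) :+ (t :* inv) :* ((x :+ s :* B) :+ (:- s) :* A))
               refl (x i) t s inv (𝟙 (⁅ a ⁆ i)) (𝟙 (⁅ b ⁆ i)) ⟩
  (s * inv) * ((x i + t * A) + (- t) * B) + (t * inv) * ((x i + s * B) + (- s) * A)
    ≡⟨ sym (cong₂ (λ u v → (s * inv) * u + (t * inv) * v)
                  (cong₂ (λ u v → (x i + u) + v) (if-then-0≡*𝟙 (⁅ a ⁆ i) t) (if-then-0≡*𝟙 (⁅ b ⁆ i) (- t)))
                  (cong₂ (λ u v → (x i + u) + v) (if-then-0≡*𝟙 (⁅ b ⁆ i) s) (if-then-0≡*𝟙 (⁅ a ⁆ i) (- s)))) ⟩
  (s * inv) * transfer a b t x i + (t * inv) * transfer b a s x i ∎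
  where
  open ≡-Reasoning
  A = 𝟙 (⁅ a ⁆ i)
  B = 𝟙 (⁅ b ⁆ i)

transfer-≤ : ∀ α β {s t d} → 0ℚ ≤ t → s ≤ d → (α ≡ true → β ≡ false → s + t ≤ d) →
             (s + (if α then t else 0ℚ)) + (if β then - t else 0ℚ) ≤ d
transfer-≤ true  false {s} {t} 0≤t s≤d s+t≤d = ℚP.≤-trans (ℚP.≤-reflexive (ℚP.+-identityʳ (s + t))) (s+t≤d refl refl)
transfer-≤ true  true  {s} {t} 0≤t s≤d _     =
  ℚP.≤-trans (ℚP.≤-reflexive (solve 2 (λ s t → (s :+ t) :+ (:- t) := s) refl s t)) s≤d
transfer-≤ false true  {s} {t} 0≤t s≤d _     =
  ℚP.≤-trans (ℚP.≤-reflexive (cong (_- t) (ℚP.+-identityʳ s))) (ℚP.≤-trans (0≤q⇒p-q≤p 0≤t) s≤d)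
transfer-≤ false false {s}     0≤t s≤d _     =
  ℚP.≤-trans (ℚP.≤-reflexive (trans (ℚP.+-identityʳ _) (ℚP.+-identityʳ s))) s≤d

𝟙-∧ : ∀ a b → 𝟙 (a ∧ b) ≡ 𝟙 a * 𝟙 b
𝟙-∧ true  b = sym (ℚP.*-identityˡ (𝟙 b))
𝟙-∧ false b = sym (ℚP.*-zeroˡ (𝟙 b))

𝟙-allᶠ : ∀ {k} (f : Fin k → Bool) → 𝟙 (allᶠ f) ≡ Πᶠ (𝟙 ∘ f)
𝟙-allᶠ {zero}  f = refl
𝟙-allᶠ {suc k} f = trans (𝟙-∧ (f zero) (allᶠ (f ∘ suc))) (cong (𝟙 (f zero) *_) (𝟙-allᶠ (f ∘ suc)))

ΣΩ-cong : ∀ k {g h : (Fin k → Bool) → ℚ} → (∀ ω → g ω ≡ h ω) → ΣΩ k g ≡ ΣΩ k h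
ΣΩ-cong zero    g≗h = g≗h _
ΣΩ-cong (suc k) g≗h = cong₂ _+_ (ΣΩ-cong k (g≗h ∘ (true VF.∷_))) (ΣΩ-cong k (g≗h ∘ (false VF.∷_)))

ΣΩ-*ˡ : ∀ k c (g : (Fin k → Bool) → ℚ) → ΣΩ k (λ ω → c * g ω) ≡ c * ΣΩ k g
ΣΩ-*ˡ zero    c g = refl
ΣΩ-*ˡ (suc k) c g = trans (cong₂ _+_ (ΣΩ-*ˡ k c _) (ΣΩ-*ˡ k c _)) (sym (ℚP.*-distribˡ-+ c _ _))

ΣΩ-Πᶠ : ∀ k (H : Fin k → Bool → ℚ) → ΣΩ k (λ ω → Πᶠ (λ j → H j (ω j))) ≡ Πᶠ (λ j → H j true + H j false)
ΣΩ-Πᶠ zero    H = refl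
ΣΩ-Πᶠ (suc k) H = begin
  ΣΩ k (λ ω → H zero true * Πᶠ (λ j → H′ j (ω j))) + ΣΩ k (λ ω → H zero false * Πᶠ (λ j → H′ j (ω j)))
    ≡⟨ cong₂ _+_ (ΣΩ-*ˡ k (H zero true) _) (ΣΩ-*ˡ k (H zero false) _) ⟩
  H zero true * ΣΩ k (λ ω → Πᶠ (λ j → H′ j (ω j))) + H zero false * ΣΩ k (λ ω → Πᶠ (λ j → H′ j (ω j)))
    ≡⟨ cong₂ (λ u v → H zero true * u + H zero false * v) (ΣΩ-Πᶠ k H′) (ΣΩ-Πᶠ k H′) ⟩
  H zero true * P + H zero false * P
    ≡⟨ sym (ℚP.*-distribʳ-+ P (H zero true) (H zero false)) ⟩
  (H zero true + H zero false) * P ∎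
  where
  open ≡-Reasoning
  H′ : Fin k → Bool → ℚ
  H′ = H ∘ suc
  P : ℚ
  P = Πᶠ (λ j → H′ j true + H′ j false)

precedes-irrefl : ∀ {k} (π : Permutation′ k) i → precedes π i i ≡ false
precedes-irrefl π i with toℕ (π ⟨$⟩ʳ i) ℕ.<? toℕ (π ⟨$⟩ʳ i)
... | yes i<i = contradiction i<i (ℕP.<-irrefl refl)
... | no  _   = refl

earliestFactor : ∀ {k} → (Fin k → ℚ) → Permutation′ k → Fin k → Fin k → ℚ
earliestFactor p π i j = (if precedes π j i then 1ℚ - p j else 1ℚ) * (if ⁅ i ⁆ j then p j else 1ℚ)

earliestProb : ∀ {k} → (Fin k → ℚ) → Permutation′ k → Fin k → ℚ
earliestProb p π i = Πᶠ (earliestFactor p π i)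

ΣΩ-earliest : ∀ {k} (p : Fin k → ℚ) (π : Permutation′ k) (i : Fin k) →
              ΣΩ k (λ ω → weight p ω * 𝟙 (earliest π ω i)) ≡ earliestProb p π i
ΣΩ-earliest {k} p π i = trans (ΣΩ-cong k factorise) (trans (ΣΩ-Πᶠ k H) (Prodᶠ.sum-cong-≗ marginal))
  where
  H : Fin k → Bool → ℚ
  H j b = (if b then p j else 1ℚ - p j) * ((if ⁅ i ⁆ j then 𝟙 b else 1ℚ) * 𝟙 (not (precedes π j i) ∨ not b))

  factorise : ∀ ω → weight p ω * 𝟙 (earliest π ω i) ≡ Πᶠ (λ j → H j (ω j))
  factorise ω = begin
    weight p ω * 𝟙 (ω i ∧ allᶠ F)
      ≡⟨ cong (weight p ω *_) (𝟙-∧ (ω i) (allᶠ F)) ⟩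
    weight p ω * (𝟙 (ω i) * 𝟙 (allᶠ F))
      ≡⟨ cong (weight p ω *_) (cong₂ _*_ (sym (prodOn-⁅⁆ i (𝟙 ∘ ω))) (𝟙-allᶠ F)) ⟩
    weight p ω * (prodOn ⁅ i ⁆ (𝟙 ∘ ω) * Πᶠ (𝟙 ∘ F))
      ≡⟨ cong (weight p ω *_) (sym (Prodᶠ.∑-distrib-+ _ (𝟙 ∘ F))) ⟩
    weight p ω * Πᶠ (λ j → (if ⁅ i ⁆ j then 𝟙 (ω j) else 1ℚ) * 𝟙 (F j))
      ≡⟨ sym (Prodᶠ.∑-distrib-+ (λ j → if ω j then p j else 1ℚ - p j) _) ⟩
    Πᶠ (λ j → H j (ω j)) ∎
    where
    open ≡-Reasoning
    F : Fin k → Bool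
    F j = not (precedes π j i) ∨ not (ω j)

  marginal : ∀ j → H j true + H j false ≡ earliestFactor p π i j
  marginal j with j ≟ i
  ... | yes refl rewrite precedes-irrefl π j =
    solve 1 (λ a → a :* (con 1ℚ :* con 1ℚ) :+ (con 1ℚ :- a) :* (con 0ℚ :* con 1ℚ) := con 1ℚ :* a) refl (p j)
  ... | no _ with precedes π j i
  ...   | true  =
    solve 1 (λ a → a :* (con 1ℚ :* con 0ℚ) :+ (con 1ℚ :- a) :* (con 1ℚ :* con 1ℚ) := (con 1ℚ :- a) :* con 1ℚ)
            refl (p j)
  ...   | false =
    solve 1 (λ a → a :* (con 1ℚ :* con 1ℚ) :+ (con 1ℚ :- a) :* (con 1ℚ :* con 1ℚ) := con 1ℚ :* con 1ℚ) refl (p j)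

<?-suc : ∀ a b → ⌊ suc a ℕ.<? suc b ⌋ ≡ ⌊ a ℕ.<? b ⌋
<?-suc a b with suc a ℕ.<? suc b | a ℕ.<? b
... | yes _   | yes _   = refl
... | no  _   | no  _   = refl
... | yes 1+a<1+b | no a≮b = contradiction (ℕ.s≤s⁻¹ 1+a<1+b) a≮b
... | no 1+a≮1+b  | yes a<b = contradiction (ℕ.s≤s a<b) 1+a≮1+b

module _ {n} (j : Fin (suc n)) (π′ : Permutation′ n) where

  private
    π : Permutation′ (suc n)
    π = insert j zero π′

    π-j : π ⟨$⟩ʳ j ≡ zero
    π-j with j ≟ j
    ... | yes _  = refl
    ... | no j≢j = contradiction refl j≢j

    precedes-insert : ∀ y i′ → precedes π (punchIn j y) (punchIn j i′) ≡ precedes π′ y i′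
    precedes-insert y i′ rewrite insert-punchIn j zero π′ y | insert-punchIn j zero π′ i′ =
      <?-suc (toℕ (π′ ⟨$⟩ʳ y)) (toℕ (π′ ⟨$⟩ʳ i′))

  earliestProb-insert-self : ∀ p → earliestProb p π j ≡ p j
  earliestProb-insert-self p = trans (Πᶠ-single j (earliestFactor p π j) others) at-j
    where
    at-j : earliestFactor p π j j ≡ p j
    at-j rewrite precedes-irrefl π j | a∈⁅a⁆ j = ℚP.*-identityˡ (p j)
    others : ∀ y → earliestFactor p π j (punchIn j y) ≡ 1ℚ
    others y rewrite punchIn∉⁅⁆ j y | insert-punchIn j zero π′ y | π-j = refl

  earliestProb-insert-punchIn : ∀ p i′ →
    earliestProb p π (punchIn j i′) ≡ (1ℚ - p j) * earliestProb (p ∘ punchIn j) π′ i′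
  earliestProb-insert-punchIn p i′ =
    trans (Prodᶠ.sum-remove {i = j} (earliestFactor p π (punchIn j i′))) (cong₂ _*_ at-j (Prodᶠ.sum-cong-≗ others))
    where
    at-j : earliestFactor p π (punchIn j i′) j ≡ 1ℚ - p j
    at-j rewrite dec-false (j ≟ punchIn j i′) (punchInᵢ≢i j i′ ∘ sym) | insert-punchIn j zero π′ i′ | π-j =
      ℚP.*-identityʳ (1ℚ - p j)
    others : ∀ y → earliestFactor p π (punchIn j i′) (punchIn j y) ≡ earliestFactor (p ∘ punchIn j) π′ i′ y
    others y rewrite precedes-insert y i′ with y ≟ i′
    ... | yes refl rewrite a∈⁅a⁆ (punchIn j y) = refl
    ... | no y≢i′ rewrite dec-false (punchIn j y ≟ punchIn j i′) (y≢i′ ∘ punchIn-injective j y i′) = refl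

earliestProb-0≤ : ∀ {k} {p : Fin k → ℚ} → (∀ i → 0ℚ ≤ p i) → (∀ i → p i ≤ 1ℚ) →
                  ∀ π i → 0ℚ ≤ earliestProb p π i
earliestProb-0≤ 0≤p p≤1 π i =
  Πᶠ-0≤ _ (λ j → 0≤*0≤⇒0≤ (if-0≤ (precedes π j i) (p≤q⇒0≤q-p (p≤1 j)) 0≤1) (if-0≤ (⁅ i ⁆ j) (0≤p j) 0≤1))

firstProb : ∀ {k} → (Fin k → ℚ) → List (Fin k) → Fin k → ℚ
firstProb p []      i = 0ℚ
firstProb p (j ∷ ℓ) i = if ⁅ i ⁆ j then p i else (1ℚ - p j) * firstProb p ℓ i

firstProb-0≤ : ∀ {k} {p : Fin k → ℚ} → (∀ i → 0ℚ ≤ p i) → (∀ i → p i ≤ 1ℚ) →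
               ∀ ℓ i → 0ℚ ≤ firstProb p ℓ i
firstProb-0≤ 0≤p p≤1 []      i = ℚP.≤-refl
firstProb-0≤ 0≤p p≤1 (j ∷ ℓ) i =
  if-0≤ (⁅ i ⁆ j) (0≤p i) (0≤*0≤⇒0≤ (p≤q⇒0≤q-p (p≤1 j)) (firstProb-0≤ 0≤p p≤1 ℓ i))

without : ∀ {n} → Fin (suc n) → List (Fin (suc n)) → List (Fin n)
without j [] = []
without j (x ∷ ℓ) with j ≟ x
... | yes _   = without j ℓ
... | no  j≢x = punchOut j≢x ∷ without j ℓ

firstProb-without : ∀ {n} {p : Fin (suc n) → ℚ} → (∀ i → 0ℚ ≤ p i) → (∀ i → p i ≤ 1ℚ) →
  ∀ j i′ ℓ → firstProb p ℓ (punchIn j i′) ≤ firstProb (p ∘ punchIn j) (without j ℓ) i′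
firstProb-without 0≤p p≤1 j i′ [] = ℚP.≤-refl
firstProb-without 0≤p p≤1 j i′ (x ∷ ℓ) with j ≟ x
... | yes refl rewrite dec-false (j ≟ punchIn j i′) (punchInᵢ≢i j i′ ∘ sym) =
  ℚP.≤-trans (≤1⇒*≤ (0≤q⇒p-q≤p (0≤p j)) (firstProb-0≤ 0≤p p≤1 ℓ _)) (firstProb-without 0≤p p≤1 j i′ ℓ)
... | no j≢x with x ≟ punchIn j i′ | punchOut j≢x ≟ i′
...   | yes _ | yes _ = ℚP.≤-refl
...   | yes x≡ | no ≢i′ = contradiction (punchIn-injective j _ _ (trans (punchIn-punchOut j≢x) x≡)) ≢i′
...   | no x≢ | yes ≡i′ = contradiction (trans (sym (punchIn-punchOut j≢x)) (cong (punchIn j) ≡i′)) x≢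
...   | no _  | no _ rewrite punchIn-punchOut j≢x =
  *-monoʳ-≤-0≤ (p≤q⇒0≤q-p (p≤1 x)) (firstProb-without 0≤p p≤1 j i′ ℓ)

toPermutation : ∀ {k} → List (Fin k) → Permutation′ k
toPermutation {zero}  ℓ       = id
toPermutation {suc n} []      = id
toPermutation {suc n} (j ∷ ℓ) = insert j zero (toPermutation (without j ℓ))

firstProb≤earliestProb : ∀ {k} {p : Fin k → ℚ} → (∀ i → 0ℚ ≤ p i) → (∀ i → p i ≤ 1ℚ) →
                         ∀ ℓ i → firstProb p ℓ i ≤ earliestProb p (toPermutation ℓ) i
firstProb≤earliestProb {suc n} 0≤p p≤1 [] i = earliestProb-0≤ 0≤p p≤1 id i
firstProb≤earliestProb {suc n} {p} 0≤p p≤1 (j ∷ ℓ) i = by-cases (j ≟ i)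
  where
  π′ = toPermutation (without j ℓ)

  at-punchIn : ∀ i′ → firstProb p (j ∷ ℓ) (punchIn j i′) ≤ earliestProb p (insert j zero π′) (punchIn j i′)
  at-punchIn i′ rewrite dec-false (j ≟ punchIn j i′) (punchInᵢ≢i j i′ ∘ sym) = begin
    (1ℚ - p j) * firstProb p ℓ (punchIn j i′)
      ≤⟨ *-monoʳ-≤-0≤ (p≤q⇒0≤q-p (p≤1 j)) (firstProb-without 0≤p p≤1 j i′ ℓ) ⟩
    (1ℚ - p j) * firstProb (p ∘ punchIn j) (without j ℓ) i′
      ≤⟨ *-monoʳ-≤-0≤ (p≤q⇒0≤q-p (p≤1 j)) (firstProb≤earliestProb (0≤p ∘ punchIn j) (p≤1 ∘ punchIn j) _ i′) ⟩
    (1ℚ - p j) * earliestProb (p ∘ punchIn j) π′ i′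
      ≡⟨ sym (earliestProb-insert-punchIn j π′ p i′) ⟩
    earliestProb p (insert j zero π′) (punchIn j i′) ∎
    where open ℚP.≤-Reasoning

  by-cases : Dec (j ≡ i) → firstProb p (j ∷ ℓ) i ≤ earliestProb p (insert j zero π′) i
  by-cases (yes refl) = ℚP.≤-reflexive (trans (cong (if_then p j else (1ℚ - p j) * firstProb p ℓ j) (a∈⁅a⁆ j))
                                               (sym (earliestProb-insert-self j π′ p)))
  by-cases (no j≢i)   = subst (λ i → firstProb p (j ∷ ℓ) i ≤ earliestProb p (insert j zero π′) i)
                              (punchIn-punchOut j≢i) (at-punchIn (punchOut j≢i))

module Polymatroid {k} (p : Fin k → ℚ) (0≤p : ∀ i → 0ℚ ≤ p i) (p≤1 : ∀ i → p i ≤ 1ℚ) where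

  q : Fin k → ℚ
  q i = 1ℚ - p i

  0≤q : ∀ i → 0ℚ ≤ q i
  0≤q i = p≤q⇒0≤q-p (p≤1 i)

  noneOf : Subset k → ℚ
  noneOf W = prodOn W q

  someOf : Subset k → ℚ
  someOf W = 1ℚ - noneOf W

  noneOf-0≤ : ∀ W → 0ℚ ≤ noneOf W
  noneOf-0≤ W = Πᶠ-0≤ _ (λ i → if-0≤ (W i) (0≤q i) 0≤1)

  noneAlong : List (Fin k) → ℚ
  noneAlong []      = 1ℚ
  noneAlong (j ∷ ℓ) = q j * noneAlong ℓ

  noneAlong-++ : ∀ ℓ₁ ℓ₂ → noneAlong (ℓ₁ ++ ℓ₂) ≡ noneAlong ℓ₁ * noneAlong ℓ₂
  noneAlong-++ []       ℓ₂ = sym (ℚP.*-identityˡ (noneAlong ℓ₂))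
  noneAlong-++ (j ∷ ℓ₁) ℓ₂ =
    trans (cong (q j *_) (noneAlong-++ ℓ₁ ℓ₂)) (sym (ℚP.*-assoc (q j) (noneAlong ℓ₁) (noneAlong ℓ₂)))

  firstProb-++ˡ : ∀ ℓ₁ ℓ₂ i → firstProb p ℓ₁ i ≤ firstProb p (ℓ₁ ++ ℓ₂) i
  firstProb-++ˡ []       ℓ₂ i = firstProb-0≤ 0≤p p≤1 ℓ₂ i
  firstProb-++ˡ (j ∷ ℓ₁) ℓ₂ i with ⁅ i ⁆ j
  ... | true  = ℚP.≤-refl
  ... | false = *-monoʳ-≤-0≤ (0≤q j) (firstProb-++ˡ ℓ₁ ℓ₂ i)

  firstProb-++-∉ : ∀ ℓ₁ ℓ₂ i → All (_≢ i) ℓ₁ → firstProb p (ℓ₁ ++ ℓ₂) i ≡ noneAlong ℓ₁ * firstProb p ℓ₂ i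
  firstProb-++-∉ []       ℓ₂ i []           = sym (ℚP.*-identityˡ (firstProb p ℓ₂ i))
  firstProb-++-∉ (j ∷ ℓ₁) ℓ₂ i (j≢i ∷ ℓ₁∌i) rewrite dec-false (j ≟ i) j≢i =
    trans (cong (q j *_) (firstProb-++-∉ ℓ₁ ℓ₂ i ℓ₁∌i)) (sym (ℚP.*-assoc (q j) (noneAlong ℓ₁) (firstProb p ℓ₂ i)))

  -- Weaker than ℓ enumerating U, but it is all that the composition of orders needs.
  Exhausts : Subset k → List (Fin k) → Set
  Exhausts U ℓ = All (_∈ U) ℓ × noneAlong ℓ ≡ noneOf U

  Mixture : Set
  Mixture = List (List (Fin k) × ℚ)

  mass : Mixture → ℚ
  mass []            = 0ℚ
  mass ((_ , w) ∷ D) = w + mass D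

  expectedFirst : Mixture → Fin k → ℚ
  expectedFirst []            i = 0ℚ
  expectedFirst ((ℓ , w) ∷ D) i = w * firstProb p ℓ i + expectedFirst D i

  NonNegWeights : Mixture → Set
  NonNegWeights = All ((0ℚ ≤_) ∘ proj₂)

  _·_ : ℚ → Mixture → Mixture
  c · D = map (λ (ℓ , w) → ℓ , c * w) D

  concatOrders : List (Fin k) × ℚ → List (Fin k) × ℚ → List (Fin k) × ℚ
  concatOrders (ℓ₁ , w₁) (ℓ₂ , w₂) = ℓ₁ ++ ℓ₂ , w₁ * w₂

  _⊗_ : Mixture → Mixture → Mixture
  _⊗_ = cartesianProductWith concatOrders

  All-⊗ : ∀ {P₁ P₂ P : List (Fin k) × ℚ → Set} → (∀ {a b} → P₁ a → P₂ b → P (concatOrders a b)) →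
          ∀ {D₁ D₂} → All P₁ D₁ → All P₂ D₂ → All P (D₁ ⊗ D₂)
  All-⊗ combine []         _   = []
  All-⊗ combine (pa ∷ ps₁) ps₂ = ++⁺ (map⁺ (All.map (combine pa) ps₂)) (All-⊗ combine ps₁ ps₂)

  mass-++ : ∀ D₁ D₂ → mass (D₁ ++ D₂) ≡ mass D₁ + mass D₂
  mass-++ []             D₂ = sym (ℚP.+-identityˡ (mass D₂))
  mass-++ ((_ , w) ∷ D₁) D₂ = trans (cong (w +_) (mass-++ D₁ D₂)) (sym (ℚP.+-assoc w (mass D₁) (mass D₂)))

  expectedFirst-++ : ∀ D₁ D₂ i → expectedFirst (D₁ ++ D₂) i ≡ expectedFirst D₁ i + expectedFirst D₂ i
  expectedFirst-++ []             D₂ i = sym (ℚP.+-identityˡ (expectedFirst D₂ i))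
  expectedFirst-++ ((ℓ , w) ∷ D₁) D₂ i =
    trans (cong (w * firstProb p ℓ i +_) (expectedFirst-++ D₁ D₂ i))
          (sym (ℚP.+-assoc (w * firstProb p ℓ i) (expectedFirst D₁ i) (expectedFirst D₂ i)))

  mass-· : ∀ c D → mass (c · D) ≡ c * mass D
  mass-· c []            = sym (ℚP.*-zeroʳ c)
  mass-· c ((_ , w) ∷ D) = trans (cong (c * w +_) (mass-· c D)) (sym (ℚP.*-distribˡ-+ c w (mass D)))

  expectedFirst-· : ∀ c D i → expectedFirst (c · D) i ≡ c * expectedFirst D i
  expectedFirst-· c []            i = sym (ℚP.*-zeroʳ c)
  expectedFirst-· c ((ℓ , w) ∷ D) i =
    trans (cong₂ _+_ (ℚP.*-assoc c w (firstProb p ℓ i)) (expectedFirst-· c D i))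
          (sym (ℚP.*-distribˡ-+ c (w * firstProb p ℓ i) (expectedFirst D i)))

  mass-⊗ : ∀ D₁ D₂ → mass (D₁ ⊗ D₂) ≡ mass D₁ * mass D₂
  mass-⊗ []              D₂ = sym (ℚP.*-zeroˡ (mass D₂))
  mass-⊗ ((ℓ₁ , w₁) ∷ D₁) D₂ = begin
    mass (map (concatOrders (ℓ₁ , w₁)) D₂ ++ D₁ ⊗ D₂)        ≡⟨ mass-++ (map (concatOrders (ℓ₁ , w₁)) D₂) _ ⟩
    mass (map (concatOrders (ℓ₁ , w₁)) D₂) + mass (D₁ ⊗ D₂)  ≡⟨ cong₂ _+_ (mass-prefix D₂) (mass-⊗ D₁ D₂) ⟩
    w₁ * mass D₂ + mass D₁ * mass D₂                         ≡⟨ sym (ℚP.*-distribʳ-+ (mass D₂) w₁ (mass D₁)) ⟩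
    (w₁ + mass D₁) * mass D₂                                 ∎
    where
    open ≡-Reasoning
    mass-prefix : ∀ D → mass (map (concatOrders (ℓ₁ , w₁)) D) ≡ w₁ * mass D
    mass-prefix []            = sym (ℚP.*-zeroʳ w₁)
    mass-prefix ((_ , w) ∷ D) = trans (cong (w₁ * w +_) (mass-prefix D)) (sym (ℚP.*-distribˡ-+ w₁ w (mass D)))

  expectedFirst-⊗-≥ : ∀ D₁ D₂ i → NonNegWeights D₁ → NonNegWeights D₂ →
                      expectedFirst D₁ i * mass D₂ ≤ expectedFirst (D₁ ⊗ D₂) i
  expectedFirst-⊗-≥ []               D₂ i _            _     = ℚP.≤-reflexive (ℚP.*-zeroˡ (mass D₂))
  expectedFirst-⊗-≥ ((ℓ₁ , w₁) ∷ D₁) D₂ i (0≤w₁ ∷ 0≤ws) 0≤ws₂ = begin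
    (w₁ * firstProb p ℓ₁ i + expectedFirst D₁ i) * mass D₂
      ≡⟨ ℚP.*-distribʳ-+ (mass D₂) (w₁ * firstProb p ℓ₁ i) (expectedFirst D₁ i) ⟩
    (w₁ * firstProb p ℓ₁ i) * mass D₂ + expectedFirst D₁ i * mass D₂
      ≤⟨ ℚP.+-mono-≤ (prefix-≥ D₂ 0≤ws₂) (expectedFirst-⊗-≥ D₁ D₂ i 0≤ws 0≤ws₂) ⟩
    expectedFirst (map (concatOrders (ℓ₁ , w₁)) D₂) i + expectedFirst (D₁ ⊗ D₂) i
      ≡⟨ sym (expectedFirst-++ (map (concatOrders (ℓ₁ , w₁)) D₂) (D₁ ⊗ D₂) i) ⟩
    expectedFirst (((ℓ₁ , w₁) ∷ D₁) ⊗ D₂) i ∎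
    where
    open ℚP.≤-Reasoning
    prefix-≥ : ∀ D → NonNegWeights D →
               (w₁ * firstProb p ℓ₁ i) * mass D ≤ expectedFirst (map (concatOrders (ℓ₁ , w₁)) D) i
    prefix-≥ []             _            = ℚP.≤-reflexive (ℚP.*-zeroʳ (w₁ * firstProb p ℓ₁ i))
    prefix-≥ ((ℓ₂ , w₂) ∷ D) (0≤w₂ ∷ 0≤ws) = begin
      (w₁ * firstProb p ℓ₁ i) * (w₂ + mass D)
        ≡⟨ solve 4 (λ a f b m → (a :* f) :* (b :+ m) := (a :* b) :* f :+ (a :* f) :* m) refl
                   w₁ (firstProb p ℓ₁ i) w₂ (mass D) ⟩
      (w₁ * w₂) * firstProb p ℓ₁ i + (w₁ * firstProb p ℓ₁ i) * mass D
        ≤⟨ ℚP.+-mono-≤ (*-monoʳ-≤-0≤ (0≤*0≤⇒0≤ 0≤w₁ 0≤w₂) (firstProb-++ˡ ℓ₁ ℓ₂ i)) (prefix-≥ D 0≤ws) ⟩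
      (w₁ * w₂) * firstProb p (ℓ₁ ++ ℓ₂) i + expectedFirst (map (concatOrders (ℓ₁ , w₁)) D) i ∎

  expectedFirst-⊗-∉ : ∀ T D₁ D₂ i → All (Exhausts T ∘ proj₁) D₁ → T i ≡ false →
                      expectedFirst (D₁ ⊗ D₂) i ≡ (mass D₁ * noneOf T) * expectedFirst D₂ i
  expectedFirst-⊗-∉ T []               D₂ i _                       _   =
    sym (trans (cong (_* expectedFirst D₂ i) (ℚP.*-zeroˡ (noneOf T))) (ℚP.*-zeroˡ (expectedFirst D₂ i)))
  expectedFirst-⊗-∉ T ((ℓ₁ , w₁) ∷ D₁) D₂ i ((ℓ₁⊆T , none≡) ∷ exh) i∉T = begin
    expectedFirst (map (concatOrders (ℓ₁ , w₁)) D₂ ++ D₁ ⊗ D₂) i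
      ≡⟨ expectedFirst-++ (map (concatOrders (ℓ₁ , w₁)) D₂) (D₁ ⊗ D₂) i ⟩
    expectedFirst (map (concatOrders (ℓ₁ , w₁)) D₂) i + expectedFirst (D₁ ⊗ D₂) i
      ≡⟨ cong₂ _+_ (prefix-∉ D₂) (expectedFirst-⊗-∉ T D₁ D₂ i exh i∉T) ⟩
    (w₁ * noneAlong ℓ₁) * E + (mass D₁ * noneOf T) * E
      ≡⟨ cong (λ n → (w₁ * n) * E + (mass D₁ * noneOf T) * E) none≡ ⟩
    (w₁ * noneOf T) * E + (mass D₁ * noneOf T) * E
      ≡⟨ solve 4 (λ a m n e → (a :* n) :* e :+ (m :* n) :* e := ((a :+ m) :* n) :* e) refl
                 w₁ (mass D₁) (noneOf T) E ⟩
    ((w₁ + mass D₁) * noneOf T) * E ∎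
    where
    open ≡-Reasoning
    E : ℚ
    E = expectedFirst D₂ i
    ℓ₁∌i : All (_≢ i) ℓ₁
    ℓ₁∌i = All.map (λ j∈T j≡i → contradiction (trans (sym j∈T) (subst (λ j → T j ≡ false) (sym j≡i) i∉T)) λ ()) ℓ₁⊆T
    prefix-∉ : ∀ D → expectedFirst (map (concatOrders (ℓ₁ , w₁)) D) i ≡ (w₁ * noneAlong ℓ₁) * expectedFirst D i
    prefix-∉ []              = sym (ℚP.*-zeroʳ (w₁ * noneAlong ℓ₁))
    prefix-∉ ((ℓ₂ , w₂) ∷ D) = begin
      (w₁ * w₂) * firstProb p (ℓ₁ ++ ℓ₂) i + expectedFirst (map (concatOrders (ℓ₁ , w₁)) D) i
        ≡⟨ cong₂ (λ f e → (w₁ * w₂) * f + e) (firstProb-++-∉ ℓ₁ ℓ₂ i ℓ₁∌i) (prefix-∉ D) ⟩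
      (w₁ * w₂) * (noneAlong ℓ₁ * firstProb p ℓ₂ i) + (w₁ * noneAlong ℓ₁) * expectedFirst D i
        ≡⟨ solve 5 (λ a b n f e → (a :* b) :* (n :* f) :+ (a :* n) :* e := (a :* n) :* (b :* f :+ e)) refl
                   w₁ w₂ (noneAlong ℓ₁) (firstProb p ℓ₂ i) (expectedFirst D i) ⟩
      (w₁ * noneAlong ℓ₁) * (w₂ * firstProb p ℓ₂ i + expectedFirst D i) ∎

  Feasible : Subset k → ℚ → (Fin k → ℚ) → Set
  Feasible U c x = ∀ W → W ⊆ U → sumOn W x ≤ c * someOf W

  Tight : Subset k → ℚ → (Fin k → ℚ) → Set
  Tight T c x = sumOn T x ≡ c * someOf T

  feasible-⊆ : ∀ {U T c x} → T ⊆ U → Feasible U c x → Feasible T c x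
  feasible-⊆ T⊆U feasible W W⊆T = feasible W (T⊆U ∘ W⊆T)

  feasible-∖ : ∀ {U T c x} → T ⊆ U → Feasible U c x → Tight T c x → Feasible (U ∖ T) (c * noneOf T) x
  feasible-∖ {U} {T} {c} {x} T⊆U feasible tight W W⊆U∖T = begin
    sumOn W x
      ≤⟨ p+q≤r⇒p≤r-q bound ⟩
    c * (1ℚ - noneOf W * noneOf T) - c * someOf T
      ≡⟨ solve 3 (λ c n t → c :* (con 1ℚ :- n :* t) :- c :* (con 1ℚ :- t) := (c :* t) :* (con 1ℚ :- n)) refl
                 c (noneOf W) (noneOf T) ⟩
    (c * noneOf T) * someOf W ∎
    where
    open ℚP.≤-Reasoning
    disjoint : ∀ {i} → i ∈ W → i ∉ T
    disjoint Wi = ∈∖⇒∉ {U = U} {T} (W⊆U∖T Wi)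
    W∪T⊆U : W ∪ T ⊆ U
    W∪T⊆U {i} i∈W∪T with W i in Wi | T i in Ti
    ... | true  | _    = ∈∖⇒∈ {U = U} {T} (W⊆U∖T Wi)
    ... | false | true = T⊆U Ti
    bound : sumOn W x + c * someOf T ≤ c * (1ℚ - noneOf W * noneOf T)
    bound = subst₂ (λ s n → s ≤ c * (1ℚ - n))
                   (trans (sumOn-∪ x disjoint) (cong (sumOn W x +_) tight)) (prodOn-∪ q disjoint)
                   (feasible (W ∪ T) W∪T⊆U)

  record Realisation (U : Subset k) (c : ℚ) (x : Fin k → ℚ) : Set where
    field
      mixture       : Mixture
      nonNegWeights : NonNegWeights mixture
      mass≡1        : mass mixture ≡ 1ℚ
      exhausts      : All (Exhausts U ∘ proj₁) mixture
      dominates     : ∀ {i} → i ∈ U → x i ≤ c * expectedFirst mixture i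

  open Realisation

  realise-order : ∀ {U c x} ℓ → Exhausts U ℓ → (∀ {i} → i ∈ U → x i ≤ c * firstProb p ℓ i) → Realisation U c x
  realise-order {c = c} ℓ ℓ-exhausts x≤ = record
    { mixture       = (ℓ , 1ℚ) ∷ []
    ; nonNegWeights = 0≤1 ∷ []
    ; mass≡1        = ℚP.+-identityʳ 1ℚ
    ; exhausts      = ℓ-exhausts ∷ []
    ; dominates     = λ {i} i∈U → subst (λ e → _ ≤ c * e)
                                        (sym (trans (ℚP.+-identityʳ _) (ℚP.*-identityˡ (firstProb p ℓ i)))) (x≤ i∈U)
    }

  realise-∅ : ∀ {U c x} → (∀ i → i ∉ U) → Realisation U c x
  realise-∅ {U} U-empty =
    realise-order [] ([] , sym noneOf-U) λ {i} i∈U → contradiction (trans (sym i∈U) (U-empty i)) λ ()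
    where
    noneOf-U : noneOf U ≡ 1ℚ
    noneOf-U = trans (Prodᶠ.sum-cong-≗ (λ i → cong (if_then q i else 1ℚ) (U-empty i))) (Prodᶠ.sum-replicate-zero k)

  realise-⁅⁆ : ∀ {U c x} a → a ∈ U → (∀ {i} → i ∈ U → i ≡ a) → Feasible U c x → Realisation U c x
  realise-⁅⁆ {U} {c} {x} a a∈U only-a feasible =
    realise-order (a ∷ []) ((a∈U ∷ []) , trans (ℚP.*-identityʳ (q a)) (sym noneOf-U))
                  (λ i∈U → subst (λ i → x i ≤ c * firstProb p (a ∷ []) i) (sym (only-a i∈U)) x-a≤)
    where
    U≗⁅a⁆ : U ≗ ⁅ a ⁆
    U≗⁅a⁆ i with i ≟ a | U i in Ui
    ... | yes refl | _     = trans (sym Ui) a∈U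
    ... | no  _    | false = refl
    ... | no  i≢a  | true  = contradiction (only-a Ui) i≢a
    noneOf-U : noneOf U ≡ q a
    noneOf-U = trans (prodOn-cong q U≗⁅a⁆) (prodOn-⁅⁆ a q)
    x-a≤ : x a ≤ c * firstProb p (a ∷ []) a
    x-a≤ = begin
      x a                    ≡⟨ sym (sumOn-⁅⁆ a x) ⟩
      sumOn ⁅ a ⁆ x          ≤⟨ feasible ⁅ a ⁆ (λ {i} i∈⁅a⁆ → trans (U≗⁅a⁆ i) i∈⁅a⁆) ⟩
      c * someOf ⁅ a ⁆       ≡⟨ cong (λ n → c * (1ℚ - n)) (prodOn-⁅⁆ a q) ⟩
      c * (1ℚ - (1ℚ - p a))  ≡⟨ cong (c *_) (solve 1 (λ p → con 1ℚ :- (con 1ℚ :- p) := p) refl (p a)) ⟩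
      c * p a                ≡⟨ cong (λ b → c * (if b then p a else q a * 0ℚ)) (sym (a∈⁅a⁆ a)) ⟩
      c * firstProb p (a ∷ []) a ∎
      where open ℚP.≤-Reasoning

  realise-convex : ∀ {U c x x₁ x₂} l m → 0ℚ ≤ l → 0ℚ ≤ m → l + m ≡ 1ℚ → (∀ i → x i ≡ l * x₁ i + m * x₂ i) →
                   Realisation U c x₁ → Realisation U c x₂ → Realisation U c x
  realise-convex {U} {c} {x} {x₁} {x₂} l m 0≤l 0≤m l+m≡1 x≡ R₁ R₂ = record
    { mixture       = l · D₁ ++ m · D₂
    ; nonNegWeights = ++⁺ (map⁺ (All.map (0≤*0≤⇒0≤ 0≤l) (nonNegWeights R₁)))
                          (map⁺ (All.map (0≤*0≤⇒0≤ 0≤m) (nonNegWeights R₂)))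
    ; mass≡1        = begin-equality
        mass (l · D₁ ++ m · D₂)          ≡⟨ mass-++ (l · D₁) (m · D₂) ⟩
        mass (l · D₁) + mass (m · D₂)    ≡⟨ cong₂ _+_ (mass-· l D₁) (mass-· m D₂) ⟩
        l * mass D₁ + m * mass D₂        ≡⟨ cong₂ (λ a b → l * a + m * b) (mass≡1 R₁) (mass≡1 R₂) ⟩
        l * 1ℚ + m * 1ℚ                  ≡⟨ cong₂ _+_ (ℚP.*-identityʳ l) (ℚP.*-identityʳ m) ⟩
        l + m                            ≡⟨ l+m≡1 ⟩
        1ℚ                               ∎
    ; exhausts      = ++⁺ (map⁺ (exhausts R₁)) (map⁺ (exhausts R₂))
    ; dominates     = λ {i} i∈U → begin
        x i                                               ≡⟨ x≡ i ⟩
        l * x₁ i + m * x₂ i                               ≤⟨ ℚP.+-mono-≤ (*-monoʳ-≤-0≤ 0≤l (dominates R₁ i∈U))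
                                                                         (*-monoʳ-≤-0≤ 0≤m (dominates R₂ i∈U)) ⟩
        l * (c * expectedFirst D₁ i) + m * (c * expectedFirst D₂ i)
          ≡⟨ solve 5 (λ c l e m f → l :* (c :* e) :+ m :* (c :* f) := c :* (l :* e :+ m :* f)) refl
                     c l (expectedFirst D₁ i) m (expectedFirst D₂ i) ⟩
        c * (l * expectedFirst D₁ i + m * expectedFirst D₂ i)
          ≡⟨ cong (c *_) (sym (trans (expectedFirst-++ (l · D₁) (m · D₂) i)
                                     (cong₂ _+_ (expectedFirst-· l D₁ i) (expectedFirst-· m D₂ i)))) ⟩
        c * expectedFirst (l · D₁ ++ m · D₂) i            ∎
    }
    where
    open ℚP.≤-Reasoning
    D₁ = mixture R₁
    D₂ = mixture R₂

  realise-⊗ : ∀ {U T c x} → T ⊆ U → 0ℚ ≤ c →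
              Realisation T c x → Realisation (U ∖ T) (c * noneOf T) x → Realisation U c x
  realise-⊗ {U} {T} {c} {x} T⊆U 0≤c R₁ R₂ = record
    { mixture       = D₁ ⊗ D₂
    ; nonNegWeights = All-⊗ 0≤*0≤⇒0≤ (nonNegWeights R₁) (nonNegWeights R₂)
    ; mass≡1        = trans (mass-⊗ D₁ D₂) (trans (cong₂ _*_ (mass≡1 R₁) (mass≡1 R₂)) (ℚP.*-identityˡ 1ℚ))
    ; exhausts      = All-⊗ (λ {a} {b} → concat-exhausts {a} {b}) (exhausts R₁) (exhausts R₂)
    ; dominates     = dominates′
    }
    where
    open ℚP.≤-Reasoning
    D₁ = mixture R₁
    D₂ = mixture R₂

    concat-exhausts : ∀ {a b} → Exhausts T (proj₁ a) → Exhausts (U ∖ T) (proj₁ b) →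
                      Exhausts U (proj₁ (concatOrders a b))
    concat-exhausts {ℓ₁ , _} {ℓ₂ , _} (ℓ₁⊆T , none₁) (ℓ₂⊆U∖T , none₂) =
      ++⁺ (All.map T⊆U ℓ₁⊆T) (All.map (∈∖⇒∈ {U = U} {T}) ℓ₂⊆U∖T) ,
      trans (noneAlong-++ ℓ₁ ℓ₂) (trans (cong₂ _*_ none₁ none₂) (sym (prodOn-∖ q T⊆U)))

    dominates′ : ∀ {i} → i ∈ U → x i ≤ c * expectedFirst (D₁ ⊗ D₂) i
    dominates′ {i} i∈U with T i in Ti
    ... | true = begin
      x i
        ≤⟨ dominates R₁ Ti ⟩
      c * expectedFirst D₁ i
        ≡⟨ cong (c *_) (sym (trans (cong (expectedFirst D₁ i *_) (mass≡1 R₂)) (ℚP.*-identityʳ _))) ⟩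
      c * (expectedFirst D₁ i * mass D₂)
        ≤⟨ *-monoʳ-≤-0≤ 0≤c (expectedFirst-⊗-≥ D₁ D₂ i (nonNegWeights R₁) (nonNegWeights R₂)) ⟩
      c * expectedFirst (D₁ ⊗ D₂) i ∎
    ... | false = begin
      x i
        ≤⟨ dominates R₂ (∈∧∉⇒∈∖ {U = U} {T} i∈U Ti) ⟩
      (c * noneOf T) * expectedFirst D₂ i
        ≡⟨ solve 3 (λ c n e → (c :* n) :* e := c :* ((con 1ℚ :* n) :* e)) refl c (noneOf T) (expectedFirst D₂ i) ⟩
      c * ((1ℚ * noneOf T) * expectedFirst D₂ i)
        ≡⟨ cong (λ m → c * ((m * noneOf T) * expectedFirst D₂ i)) (sym (mass≡1 R₁)) ⟩
      c * ((mass D₁ * noneOf T) * expectedFirst D₂ i)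
        ≡⟨ cong (c *_) (sym (expectedFirst-⊗-∉ T D₁ D₂ i (exhausts R₁) Ti)) ⟩
      c * expectedFirst (D₁ ⊗ D₂) i ∎

  realise-≗ : ∀ {U c x x′} → x ≗ x′ → Realisation U c x′ → Realisation U c x
  realise-≗ x≗x′ R = record
    { mixture       = mixture R
    ; nonNegWeights = nonNegWeights R
    ; mass≡1        = mass≡1 R
    ; exhausts      = exhausts R
    ; dominates     = λ {i} i∈U → subst (_≤ _) (sym (x≗x′ i)) (dominates R i∈U)
    }

  Realisable : Subset k → Set
  Realisable U = ∀ {c x} → 0ℚ ≤ c → Feasible U c x → Realisation U c x

  RealisableBelow : Subset k → Set
  RealisableBelow = WfRec (ℕ._<_ on ∣_∣) Realisable

  realise-split : ∀ {U T c x a b} → RealisableBelow U → 0ℚ ≤ c → Feasible U c x → T ⊆ U → Tight T c x →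
                  a ∈ T → b ∈ U → b ∉ T → Realisation U c x
  realise-split {U} {T} {c} {x} {a} smaller 0≤c feasible T⊆U tight a∈T b∈U b∉T =
    realise-⊗ T⊆U 0≤c
      (smaller {T} (∣∣-mono-< {W = T} {U} T⊆U b∈U b∉T) 0≤c (feasible-⊆ {U} {T} {c} {x} T⊆U feasible))
      (smaller {U ∖ T} (∣∣-mono-< {W = U ∖ T} {U} (λ {i} → ∈∖⇒∈ {U = U} {T} {i}) (T⊆U a∈T) a∉U∖T)
               (0≤*0≤⇒0≤ 0≤c (noneOf-0≤ T)) (feasible-∖ {U} {T} {c} {x} T⊆U feasible tight))
    where
    a∉U∖T : a ∉ U ∖ T
    a∉U∖T rewrite a∈T = ∧-zeroʳ (U a)

  module Exchange {U c x} (feasible : Feasible U c x) {a b} (a∈U : a ∈ U) (b∈U : b ∈ U) (a≢b : a ≢ b) where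

    slack : Subset k → ℚ
    slack W = c * someOf W - sumOn W x

    -- Projects onto the subsets of U that contain a but not b, so that minimising over all
    -- subsets minimises the slack over those.
    separate : Subset k → Subset k
    separate S i = if ⁅ a ⁆ i then true else if ⁅ b ⁆ i then false else U i ∧ S i

    slack-cong : ∀ {W W′} → W ≗ W′ → slack W ≡ slack W′
    slack-cong W≗W′ = cong₂ (λ n s → c * (1ℚ - n) - s) (prodOn-cong q W≗W′) (sumOn-cong x W≗W′)

    private
      minimum : Σ (Subset k) λ S → ∀ S′ → slack (separate S) ≤ slack (separate S′)
      minimum = minimiser (slack ∘ separate) λ S≗S′ →
        slack-cong λ i → cong (λ s → if ⁅ a ⁆ i then true else if ⁅ b ⁆ i then false else U i ∧ s) (S≗S′ i)

    T : Subset k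
    T = separate (proj₁ minimum)

    t : ℚ
    t = slack T

    T⊆U : T ⊆ U
    T⊆U {i} i∈T with i ≟ a | i ≟ b
    ... | yes refl | _        = a∈U
    ... | no _     | no _     = ∧-conicalˡ (U i) _ i∈T

    a∈T : a ∈ T
    a∈T rewrite a∈⁅a⁆ a = refl

    b∉T : b ∉ T
    b∉T rewrite dec-false (b ≟ a) (a≢b ∘ sym) | a∈⁅a⁆ b = refl

    0≤t : 0ℚ ≤ t
    0≤t = p≤q⇒0≤q-p (feasible T T⊆U)

    t-minimal : ∀ W → W ⊆ U → a ∈ W → b ∉ W → t ≤ slack W
    t-minimal W W⊆U a∈W b∉W =
      ℚP.≤-trans (proj₂ minimum W) (ℚP.≤-reflexive (slack-cong fixes-W))
      where
      fixes-W : separate W ≗ W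
      fixes-W i with i ≟ a | i ≟ b
      ... | yes refl | _        = sym a∈W
      ... | no _     | yes refl = sym b∉W
      ... | no _     | no _ with W i in Wi
      ...   | true  = trans (∧-identityʳ (U i)) (W⊆U Wi)
      ...   | false = ∧-zeroʳ (U i)

    x⁺ : Fin k → ℚ
    x⁺ = transfer a b t x

    feasible-x⁺ : Feasible U c x⁺
    feasible-x⁺ W W⊆U =
      ℚP.≤-trans (ℚP.≤-reflexive (sumOn-transfer W a b t x))
                 (transfer-≤ (W a) (W b) 0≤t (feasible W W⊆U)
                             λ a∈W b∉W → q≤r-p⇒p+q≤r (t-minimal W W⊆U a∈W b∉W))

    tight-x⁺ : Tight T c x⁺
    tight-x⁺ = begin
      sumOn T x⁺
        ≡⟨ sumOn-transfer T a b t x ⟩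
      (sumOn T x + (if T a then t else 0ℚ)) + (if T b then - t else 0ℚ)
        ≡⟨ cong₂ (λ α β → (sumOn T x + (if α then t else 0ℚ)) + (if β then - t else 0ℚ)) a∈T b∉T ⟩
      (sumOn T x + t) + 0ℚ
        ≡⟨ solve 2 (λ s d → (s :+ (d :- s)) :+ con 0ℚ := d) refl (sumOn T x) (c * someOf T) ⟩
      c * someOf T ∎
      where open ≡-Reasoning

    realise-x⁺ : RealisableBelow U → 0ℚ ≤ c → Realisation U c x⁺
    realise-x⁺ smaller 0≤c =
      realise-split {U} {T} {c} {x⁺} {a} {b} smaller 0≤c feasible-x⁺ T⊆U tight-x⁺ a∈T b∈U b∉T

  realise-pair : ∀ {U c x a b} → RealisableBelow U → 0ℚ ≤ c → Feasible U c x →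
                 a ∈ U → b ∈ U → a ≢ b → Realisation U c x
  realise-pair {U} {c} {x} {a} {b} smaller 0≤c feasible a∈U b∈U a≢b = by-sign (ℚP.<-cmp 0ℚ A.t)
    where
    module A = Exchange {U} {c} {x} feasible a∈U b∈U a≢b
    module B = Exchange {U} {c} {x} feasible b∈U a∈U (a≢b ∘ sym)

    by-sign : Tri (0ℚ < A.t) (0ℚ ≡ A.t) (A.t < 0ℚ) → Realisation U c x
    by-sign (tri≈ _ 0≡t _) =
      realise-≗ (λ i → sym (trans (cong (λ t → transfer a b t x i) (sym 0≡t)) (transfer-zero a b x i)))
                (A.realise-x⁺ smaller 0≤c)
    by-sign (tri> _ _ t<0) = contradiction (ℚP.<-≤-trans t<0 A.0≤t) (ℚP.<-irrefl refl)
    by-sign (tri< 0<t _ _) =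
      realise-convex (B.t * inv) (A.t * inv) (0≤*0≤⇒0≤ B.0≤t 0≤inv) (0≤*0≤⇒0≤ A.0≤t 0≤inv) weights-sum
                     (transfer-convex a b A.t B.t inv x [t+s]inv≡1)
                     (A.realise-x⁺ smaller 0≤c) (B.realise-x⁺ smaller 0≤c)
      where
      instance
        t+s-positive : Positive (A.t + B.t)
        t+s-positive = positive (ℚP.+-mono-<-≤ 0<t B.0≤t)
      inv : ℚ
      inv = (1/ (A.t + B.t)) {{ℚP.pos⇒nonZero (A.t + B.t)}}
      0≤inv : 0ℚ ≤ inv
      0≤inv = ℚP.<⇒≤ (ℚP.positive⁻¹ inv {{ℚP.1/pos⇒pos (A.t + B.t)}})
      [t+s]inv≡1 : (A.t + B.t) * inv ≡ 1ℚ
      [t+s]inv≡1 = ℚP.*-inverseʳ (A.t + B.t) {{ℚP.pos⇒nonZero (A.t + B.t)}}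
      weights-sum : B.t * inv + A.t * inv ≡ 1ℚ
      weights-sum = trans (solve 3 (λ t s i → s :* i :+ t :* i := (t :+ s) :* i) refl A.t B.t inv) [t+s]inv≡1

  realise : ∀ U → Realisable U
  realise = WF.All.wfRec (On.wellFounded ∣_∣ ℕI.<-wellFounded) _ Realisable step
    where
    step : ∀ U → RealisableBelow U → Realisable U
    step U smaller {c} {x} 0≤c feasible with any? (λ i → U i Bool.≟ true)
    ... | no  U-empty = realise-∅ (λ i → ¬-not (λ i∈U → U-empty (i , i∈U)))
    ... | yes (a , a∈U) with any? (λ i → (U i Bool.≟ true) ×-dec ¬? (i ≟ a))
    ...   | no  only-a          =
      realise-⁅⁆ a a∈U (λ {i} i∈U → decidable-stable (i ≟ a) λ i≢a → only-a (i , i∈U , i≢a)) feasible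
    ...   | yes (b , b∈U , b≢a) = realise-pair smaller 0≤c feasible a∈U b∈U (b≢a ∘ sym)

  toDist : Mixture → Dist k
  toDist = map (λ (ℓ , w) → toPermutation ℓ , w)

  totalMass-toDist : ∀ D → totalMass (toDist D) ≡ mass D
  totalMass-toDist []            = refl
  totalMass-toDist ((_ , w) ∷ D) = cong (w +_) (totalMass-toDist D)

  expectedFirst≤probEarliest : ∀ D i → NonNegWeights D → expectedFirst D i ≤ probEarliest p (toDist D) i
  expectedFirst≤probEarliest []            i _             = ℚP.≤-refl
  expectedFirst≤probEarliest ((ℓ , w) ∷ D) i (0≤w ∷ 0≤ws) =
    ℚP.+-mono-≤ (*-monoʳ-≤-0≤ 0≤w (ℚP.≤-trans (firstProb≤earliestProb 0≤p p≤1 ℓ i)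
                                             (ℚP.≤-reflexive (sym (ΣΩ-earliest p (toPermutation ℓ) i)))))
                (expectedFirst≤probEarliest D i 0≤ws)

lemma1 : (k : ℕ) (p r : Fin k → ℚ)
       → (∀ i → 0ℚ ≤ p i) → (∀ i → p i ≤ 1ℚ)
       → (∀ i → 0ℚ ≤ r i)
       → (∀ (S : Fin k → Bool) →
            Σᶠ (λ i → if S i then r i else 0ℚ)
              ≤ 1ℚ - Πᶠ (λ i → if S i then 1ℚ - p i else 1ℚ))
       → Σ (Dist k) λ d →
            All (λ πq → 0ℚ ≤ proj₂ πq) d
            × totalMass d ≡ 1ℚ
            × (∀ i → r i ≤ probEarliest p d i)
lemma1 k p r 0≤p p≤1 _ r∈polymatroid =
  toDist D , map⁺ (nonNegWeights R) , trans (totalMass-toDist D) (mass≡1 R) , r≤probEarliest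
  where
  open Polymatroid p 0≤p p≤1
  open Realisation
  R : Realisation (λ _ → true) 1ℚ r
  R = realise (λ _ → true) 0≤1 (λ W _ → subst (sumOn W r ≤_) (sym (ℚP.*-identityˡ _)) (r∈polymatroid W))
  D : Mixture
  D = mixture R
  r≤probEarliest : ∀ i → r i ≤ probEarliest p (toDist D) i
  r≤probEarliest i = ℚP.≤-trans (dominates R refl)
    (ℚP.≤-trans (ℚP.≤-reflexive (ℚP.*-identityˡ _)) (expectedFirst≤probEarliest D i (nonNegWeights R)))
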